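{- For every map $\sigma:\Delta\to\Gamma$ of bridge/path cubical sets and every type $\Gamma\vdash T$, the shape equivalence relation respects substitution: $\mathrm{SE}^T[\sigma]=\mathrm{SE}^{T[\sigma]}$.
   Context: $\mathrm{BPCube}$: pairs $W=(W_B,W_P)$ of disjoint finite sets of names; face maps assign to bridge variables values in $\{0,1\}\cup V_B$ and to path variables values in $\{0,1\}\cup V_B\cup V_P$; composition by substitution. Types $\Gamma\vdash T$ give sets $T[\gamma]$ with functorial restrictions $t\langle\varphi\rangle$, and $T[\sigma][\delta]=T[\sigma\delta]$. An equivalence relation $E$ on $T$ is an equivalence relation $E[\gamma]$ on each $T[\gamma]$ stable under restriction; $E[\sigma][\delta]:=E[\sigma\delta]$. For a fresh path variable $i$, $(\setminus i):(W,i{:}\mathbb P)\to W$ is the weakening and $(0/i,\setminus i):(W,i{:}\mathbb P)\to(W,i{:}\mathbb P)$ sends $i$ to $0$ and other variables to themselves. $\mathrm{SE}^T$ is the smallest equivalence relation on $T$ such that for every $\gamma\in\Gamma(W)$ and every $p\in T[\gamma(\setminus i)]$ we have $\mathrm{SE}^T[\gamma(\setminus i)](p,\,p\langle 0/i,\setminus i\rangle)$. -}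

module Defs where

open import Data.Nat using (ℕ; suc)
open import Data.Fin using (Fin; zero; suc)
open import Data.Vec using (Vec; _∷_; lookup; tabulate; map)
open import Data.Vec.Properties using (tabulate-∘; tabulate-cong; lookup∘tabulate)
open import Relation.Binary.PropositionalEquality
  using (_≡_; refl; sym; trans; cong; cong₂; subst)

-- The category BPCube (skeletal presentation).
-- An object W = (W_B , W_P) is given by the numbers of bridge and path
-- names; the names themselves are Fin (nb W) and Fin (np W).

record Ctx : Set where
  constructor ⟨_,_⟩
  field
    nb : ℕ
    np : ℕ
open Ctx public

-- values a bridge variable may be sent to: {0,1} ∪ V_B
data BVal (m : ℕ) : Set where
  b0 b1 : BVal m
  bvar  : Fin m → BVal m

-- values a path variable may be sent to: {0,1} ∪ V_B ∪ V_P
data PVal (m n : ℕ) : Set where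
  p0 p1 : PVal m n
  pb    : Fin m → PVal m n
  pp    : Fin n → PVal m n

-- A face map  V → W  assigns to every variable of W a value over V.
record Hom (V W : Ctx) : Set where
  constructor hom
  field
    bs : Vec (BVal (nb V)) (nb W)
    ps : Vec (PVal (nb V) (np V)) (np W)
open Hom public

b→p : ∀ {m n} → BVal m → PVal m n
b→p b0       = p0
b→p b1       = p1
b→p (bvar j) = pb j

substB : ∀ {U V} → Hom U V → BVal (nb V) → BVal (nb U)
substB ψ b0       = b0
substB ψ b1       = b1
substB ψ (bvar j) = lookup (bs ψ) j

substP : ∀ {U V} → Hom U V → PVal (nb V) (np V) → PVal (nb U) (np U)
substP ψ p0     = p0
substP ψ p1     = p1
substP ψ (pb j) = b→p (lookup (bs ψ) j)
substP ψ (pp j) = lookup (ps ψ) j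

idH : ∀ {W} → Hom W W
idH = hom (tabulate bvar) (tabulate pp)

_⊙_ : ∀ {U V W} → Hom V W → Hom U V → Hom U W
φ ⊙ ψ = hom (map (substB ψ) (bs φ)) (map (substP ψ) (ps φ))

-- adjoining a fresh path variable i (represented as path name zero)
_,P : Ctx → Ctx
W ,P = ⟨ nb W , suc (np W) ⟩

wk : ∀ {W} → Hom (W ,P) W
wk = hom (tabulate bvar) (tabulate (λ k → pp (suc k)))

z0 : ∀ {W} → Hom (W ,P) (W ,P)
z0 = hom (tabulate bvar) (p0 ∷ tabulate (λ k → pp (suc k)))

wk⊙z0 : ∀ {W} → wk {W} ⊙ z0 ≡ wk
wk⊙z0 {W} = cong₂ hom
  (trans (sym (tabulate-∘ (substB z0) bvar))
         (tabulate-cong (λ k → lookup∘tabulate bvar k)))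
  (trans (sym (tabulate-∘ (substP z0) (λ k → pp (suc k))))
         (tabulate-cong (λ k → lookup∘tabulate (λ k → pp (suc k)) k)))

record PSh : Set₁ where
  field
    ob     : Ctx → Set
    res    : ∀ {W V} → ob W → Hom V W → ob V
    res-id : ∀ {W} (γ : ob W) → res γ idH ≡ γ
    res-∘  : ∀ {U V W} (γ : ob W) (φ : Hom V W) (ψ : Hom U V) →
             res (res γ φ) ψ ≡ res γ (φ ⊙ ψ)
open PSh public

record PShHom (Δ Γ : PSh) : Set where
  field
    fun : ∀ {W} → ob Δ W → ob Γ W
    nat : ∀ {W V} (δ : ob Δ W) (φ : Hom V W) →
          fun (res Δ δ φ) ≡ res Γ (fun δ) φ
open PShHom public

-- types Γ ⊢ T (presheaves over the category of elements of Γ)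
record Ty (Γ : PSh) : Set₁ where
  field
    ty     : ∀ {W} → ob Γ W → Set
    tres   : ∀ {W V} {γ : ob Γ W} → ty γ → (φ : Hom V W) → ty (res Γ γ φ)
    tres-id : ∀ {W} {γ : ob Γ W} (t : ty γ) →
              subst ty (res-id Γ γ) (tres t idH) ≡ t
    tres-∘  : ∀ {U V W} {γ : ob Γ W} (t : ty γ) (φ : Hom V W) (ψ : Hom U V) →
              subst ty (res-∘ Γ γ φ ψ) (tres (tres t φ) ψ) ≡ tres t (φ ⊙ ψ)
open Ty public

substs : ∀ {A : Set} (P : A → Set) {a b c : A}
         (e1 : b ≡ c) (e2 : a ≡ b) (e3 : a ≡ c) (x : P a) →
         subst P e1 (subst P e2 x) ≡ subst P e3 x
substs P refl refl refl x = refl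

subst-∘' : ∀ {A B : Set} (P : B → Set) (f : A → B) {a b : A} (e : a ≡ b) (x : P (f a)) →
           subst (λ z → P (f z)) e x ≡ subst P (cong f e) x
subst-∘' P f refl x = refl

module _ {Δ Γ : PSh} where

  private
    tres-subst : (T : Ty Γ) {W V : Ctx} {γ γ' : ob Γ W} (e : γ ≡ γ') (t : ty T γ) (ψ : Hom V W) →
                 tres T (subst (ty T) e t) ψ ≡ subst (ty T) (cong (λ g → res Γ g ψ) e) (tres T t ψ)
    tres-subst T refl t ψ = refl

  _[_] : Ty Γ → PShHom Δ Γ → Ty Δ
  ty (T [ σ ]) δ = ty T (fun σ δ)
  tres (T [ σ ]) {γ = δ} t φ = subst (ty T) (sym (nat σ δ φ)) (tres T t φ)
  tres-id (T [ σ ]) {γ = δ} t =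
    trans (subst-∘' (ty T) (fun σ) (res-id Δ δ) _)
    (trans (substs (ty T) (cong (fun σ) (res-id Δ δ)) (sym (nat σ δ idH)) (res-id Γ (fun σ δ)) _)
           (tres-id T t))
  tres-∘ (T [ σ ]) {γ = δ} t φ ψ =
    trans (subst-∘' (ty T) (fun σ) (res-∘ Δ δ φ ψ) _)
    (trans (cong (subst (ty T) (cong (fun σ) (res-∘ Δ δ φ ψ)))
                 (cong (subst (ty T) (sym (nat σ (res Δ δ φ) ψ)))
                       (tres-subst T (sym (nat σ δ φ)) (tres T t φ) ψ)))
    (trans (cong (subst (ty T) (cong (fun σ) (res-∘ Δ δ φ ψ)))
                 (substs (ty T) (sym (nat σ (res Δ δ φ) ψ)) (cong (λ g → res Γ g ψ) (sym (nat σ δ φ)))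
                         (trans (cong (λ g → res Γ g ψ) (sym (nat σ δ φ))) (sym (nat σ (res Δ δ φ) ψ))) _))
    (trans (substs (ty T) (cong (fun σ) (res-∘ Δ δ φ ψ))
                   (trans (cong (λ g → res Γ g ψ) (sym (nat σ δ φ))) (sym (nat σ (res Δ δ φ) ψ)))
                   (trans (res-∘ Γ (fun σ δ) φ ψ) (sym (nat σ δ (φ ⊙ ψ)))) _)
    (trans (sym (substs (ty T) (sym (nat σ δ (φ ⊙ ψ))) (res-∘ Γ (fun σ δ) φ ψ)
                         (trans (res-∘ Γ (fun σ δ) φ ψ) (sym (nat σ δ (φ ⊙ ψ)))) _))
           (cong (subst (ty T) (sym (nat σ δ (φ ⊙ ψ)))) (tres-∘ T t φ ψ))))))

wk-z0 : (Γ : PSh) {W : Ctx} (γ : ob Γ W) → res Γ (res Γ γ wk) z0 ≡ res Γ γ (wk {W})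
wk-z0 Γ γ = trans (res-∘ Γ γ wk z0) (cong (res Γ γ) wk⊙z0)

data SE {Γ : PSh} (T : Ty Γ) : ∀ {W} (γ : ob Γ W) → ty T γ → ty T γ → Set where
  se-gen   : ∀ {W} (γ : ob Γ W) (p : ty T (res Γ γ (wk {W}))) →
             SE T (res Γ γ wk) p (subst (ty T) (wk-z0 Γ γ) (tres T p z0))
  se-refl  : ∀ {W} {γ : ob Γ W} {x} → SE T γ x x
  se-sym   : ∀ {W} {γ : ob Γ W} {x y} → SE T γ x y → SE T γ y x
  se-trans : ∀ {W} {γ : ob Γ W} {x y z} → SE T γ x y → SE T γ y z → SE T γ x z
  se-res   : ∀ {W V} {γ : ob Γ W} {x y} (φ : Hom V W) →
             SE T γ x y → SE T (res Γ γ φ) (tres T x φ) (tres T y φ)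

-- (⊆) This is the substantial direction: a generator (p , p⟨0/i⟩) of SE^T
--     lives over γ(\i), which need not be in the image of σ, and it may be
--     restricted along an arbitrary face map φ = (ψ , a/i) : V → (W , i).
--     We therefore prove the stronger statement that SE^T(x , y) implies
--     SE^{T[σ]}(x⟨φ⟩ , y⟨φ⟩) whenever the base γ⟨φ⟩ lies in the image of σ.
--     For a generator, φ = φ⁺ ⊙ (a/i) factors through the lift
--     φ⁺ = (ψ(\i) , i/i) and the section (a/i), and z0 ⊙ φ = (φ⁺ ⊙ z0) ⊙ (a/i);
--     since γ(\i)⟨φ⁺⟩ is σ(δ)(\i), the element p⟨φ⁺⟩ gives a generator of
--     SE^{T[σ]} over δ(\i), whose restriction along (a/i) is the required pair.

module Submission where

open import Defs
open import Function.Bundles using (_⇔_; mk⇔)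
open import Data.Fin using (zero; suc)
open import Data.Vec using (_∷_; lookup)
open import Data.Vec.Properties
  using (tabulate-∘; lookup∘tabulate; tabulate∘lookup; lookup-map; map-∘; map-cong; map-id)
open import Data.Product using (Σ; _,_; proj₁)
open import Relation.Binary.PropositionalEquality
  using (_≡_; refl; sym; trans; cong; cong₂; subst; module ≡-Reasoning)

open ≡-Reasoning

substP-b→p : ∀ {U V} (ψ : Hom U V) (b : BVal (nb V)) →
             substP ψ (b→p b) ≡ b→p (substB ψ b)
substP-b→p ψ b0       = refl
substP-b→p ψ b1       = refl
substP-b→p ψ (bvar j) = refl

substB-⊙ : ∀ {U V W} (φ : Hom V W) (ψ : Hom U V) (b : BVal (nb W)) →
           substB (φ ⊙ ψ) b ≡ substB ψ (substB φ b)
substB-⊙ φ ψ b0       = refl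
substB-⊙ φ ψ b1       = refl
substB-⊙ φ ψ (bvar j) = lookup-map j (substB ψ) (bs φ)

substP-⊙ : ∀ {U V W} (φ : Hom V W) (ψ : Hom U V) (p : PVal (nb W) (np W)) →
           substP (φ ⊙ ψ) p ≡ substP ψ (substP φ p)
substP-⊙ φ ψ p0     = refl
substP-⊙ φ ψ p1     = refl
substP-⊙ φ ψ (pb j) = trans (cong b→p (lookup-map j (substB ψ) (bs φ)))
                            (sym (substP-b→p ψ (lookup (bs φ) j)))
substP-⊙ φ ψ (pp j) = lookup-map j (substP ψ) (ps φ)

substB-id : ∀ {W} (b : BVal (nb W)) → substB (idH {W}) b ≡ b
substB-id b0       = refl
substB-id b1       = refl
substB-id (bvar j) = lookup∘tabulate bvar j

substP-id : ∀ {W} (p : PVal (nb W) (np W)) → substP (idH {W}) p ≡ p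
substP-id p0     = refl
substP-id p1     = refl
substP-id (pb j) = cong b→p (lookup∘tabulate bvar j)
substP-id (pp j) = lookup∘tabulate pp j

⊙-assoc : ∀ {T U V W} (φ : Hom V W) (ψ : Hom U V) (χ : Hom T U) →
          (φ ⊙ ψ) ⊙ χ ≡ φ ⊙ (ψ ⊙ χ)
⊙-assoc φ ψ χ = cong₂ hom
  (trans (sym (map-∘ (substB χ) (substB ψ) (bs φ)))
         (map-cong (λ b → sym (substB-⊙ ψ χ b)) (bs φ)))
  (trans (sym (map-∘ (substP χ) (substP ψ) (ps φ)))
         (map-cong (λ p → sym (substP-⊙ ψ χ p)) (ps φ)))

⊙-idʳ : ∀ {V W} (φ : Hom V W) → φ ⊙ idH ≡ φ
⊙-idʳ φ = cong₂ hom (trans (map-cong substB-id (bs φ)) (map-id (bs φ)))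
                    (trans (map-cong substP-id (ps φ)) (map-id (ps φ)))

-- A face map V → (W , i) is a face map ψ : V → W together with a value a
-- for i; hom B (a ∷ R) is definitionally ext (hom B R) a.
ext : ∀ {V W} → Hom V W → PVal (nb V) (np V) → Hom V (W ,P)
ext ψ a = hom (bs ψ) (a ∷ ps ψ)

-- Forgetting i recovers ψ.  Note that z0 is ext wk p0 by definition.
wk-ext : ∀ {V W} (ψ : Hom V W) (a : PVal (nb V) (np V)) → wk ⊙ ext ψ a ≡ ψ
wk-ext ψ a = cong₂ hom
  (trans (sym (tabulate-∘ (substB (ext ψ a)) bvar)) (tabulate∘lookup (bs ψ)))
  (trans (sym (tabulate-∘ (substP (ext ψ a)) (λ k → pp (suc k))))
         (tabulate∘lookup (ps ψ)))

section : ∀ {V} → PVal (nb V) (np V) → Hom V (V ,P)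
section a = ext idH a

lift : ∀ {V W} → Hom V W → Hom (V ,P) (W ,P)
lift ψ = ext (ψ ⊙ wk) (pp zero)

wk-section : ∀ {V W} (ψ : Hom V W) (a : PVal (nb V) (np V)) →
             (ψ ⊙ wk) ⊙ section a ≡ ψ
wk-section ψ a = begin
  (ψ ⊙ wk) ⊙ section a  ≡⟨ ⊙-assoc ψ wk (section a) ⟩
  ψ ⊙ (wk ⊙ section a)  ≡⟨ cong (ψ ⊙_) (wk-ext idH a) ⟩
  ψ ⊙ idH               ≡⟨ ⊙-idʳ ψ ⟩
  ψ                     ∎

lift-section : ∀ {V W} (ψ : Hom V W) (a : PVal (nb V) (np V)) →
               lift ψ ⊙ section a ≡ ext ψ a
lift-section ψ a = cong (λ χ → ext χ a) (wk-section ψ a)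

lift-z0 : ∀ {V W} (ψ : Hom V W) (a : PVal (nb V) (np V)) →
          (lift ψ ⊙ z0) ⊙ section a ≡ z0 ⊙ ext ψ a
lift-z0 ψ a = cong (λ χ → ext χ p0) (begin
  ((ψ ⊙ wk) ⊙ z0) ⊙ section a   ≡⟨ cong (_⊙ section a) (⊙-assoc ψ wk z0) ⟩
  (ψ ⊙ (wk ⊙ z0)) ⊙ section a   ≡⟨ cong (λ χ → (ψ ⊙ χ) ⊙ section a) wk⊙z0 ⟩
  (ψ ⊙ wk) ⊙ section a          ≡⟨ wk-section ψ a ⟩
  ψ                             ≡⟨ sym (wk-ext ψ a) ⟩
  wk ⊙ ext ψ a                  ∎)

wk-lift : ∀ {V W} (ψ : Hom V W) (a : PVal (nb V) (np V)) →
          wk ⊙ lift ψ ≡ (wk ⊙ ext ψ a) ⊙ wk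
wk-lift ψ a = trans (wk-ext (ψ ⊙ wk) (pp zero)) (cong (_⊙ wk) (sym (wk-ext ψ a)))

module Total {Γ : PSh} (T : Ty Γ) where

  -- Elements of T over some element of Γ; restriction acts on pairs,
  -- so equalities between elements over different bases can be stated.
  ∫ : Ctx → Set
  ∫ W = Σ (ob Γ W) (ty T)

  _·_ : ∀ {W V} → ∫ W → Hom V W → ∫ V
  (γ , t) · φ = res Γ γ φ , tres T t φ

  subst-pair : ∀ {W} {γ γ' : ob Γ W} (e : γ ≡ γ') (t : ty T γ) →
               _≡_ {A = ∫ W} (γ' , subst (ty T) e t) (γ , t)
  subst-pair refl t = refl

  ·-id : ∀ {W} (u : ∫ W) → u ≡ u · idH
  ·-id (γ , t) = trans (cong (γ ,_) (sym (tres-id T t))) (subst-pair (res-id Γ γ) _)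

  ·-∘ : ∀ {U V W} (u : ∫ W) (φ : Hom V W) (ψ : Hom U V) → (u · φ) · ψ ≡ u · (φ ⊙ ψ)
  ·-∘ (γ , t) φ ψ = trans (sym (subst-pair (res-∘ Γ γ φ ψ) _))
                          (cong (res Γ γ (φ ⊙ ψ) ,_) (tres-∘ T t φ ψ))

  generator-end : ∀ {W} (γ : ob Γ W) (p : ty T (res Γ γ wk)) →
                  _≡_ {A = ∫ (W ,P)} (res Γ γ wk , subst (ty T) (wk-z0 Γ γ) (tres T p z0))
                                     ((res Γ γ wk , p) · z0)
  generator-end γ p = subst-pair (wk-z0 Γ γ) (tres T p z0)

  SE-transport : ∀ {W} {γ γ' : ob Γ W} {x y : ty T γ} {x' y' : ty T γ'} →
                 _≡_ {A = ∫ W} (γ , x) (γ' , x') → _≡_ {A = ∫ W} (γ , y) (γ' , y') →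
                 SE T γ x y → SE T γ' x' y'
  SE-transport refl refl h = h

module _ {Δ Γ : PSh} (σ : PShHom Δ Γ) (T : Ty Γ) where
  open Total T

  subst-pair-σ : ∀ {W} {δ δ' : ob Δ W} (e : δ ≡ δ') (t : ty T (fun σ δ)) →
                 _≡_ {A = ∫ W} (fun σ δ' , subst (ty (T [ σ ])) e t) (fun σ δ , t)
  subst-pair-σ refl t = refl

  res-σ : ∀ {W V} (δ : ob Δ W) (t : ty T (fun σ δ)) (φ : Hom V W) →
          _≡_ {A = ∫ V} (fun σ (res Δ δ φ) , tres (T [ σ ]) t φ) ((fun σ δ , t) · φ)
  res-σ δ t φ = subst-pair (sym (nat σ δ φ)) (tres T t φ)

  generator-end-σ : ∀ {W} (δ : ob Δ W) (q : ty T (fun σ (res Δ δ wk))) →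
                    _≡_ {A = ∫ (W ,P)}
                      (fun σ (res Δ δ wk) , subst (ty (T [ σ ])) (wk-z0 Δ δ) (tres (T [ σ ]) q z0))
                      ((fun σ (res Δ δ wk) , q) · z0)
  generator-end-σ δ q = trans (subst-pair-σ (wk-z0 Δ δ) _) (res-σ (res Δ δ wk) q z0)

  SE[σ]-transport : ∀ {W} {δ δ' : ob Δ W} {x y : ty T (fun σ δ)} {x' y' : ty T (fun σ δ')} →
                    δ ≡ δ' →
                    _≡_ {A = ∫ W} (fun σ δ , x) (fun σ δ' , x') →
                    _≡_ {A = ∫ W} (fun σ δ , y) (fun σ δ' , y') →
                    SE (T [ σ ]) δ x y → SE (T [ σ ]) δ' x' y'
  SE[σ]-transport refl refl refl h = h

  SE[σ]⊆SE : ∀ {W} {δ : ob Δ W} {x y : ty T (fun σ δ)} →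
             SE (T [ σ ]) δ x y → SE T (fun σ δ) x y
  SE[σ]⊆SE (se-gen δ p) =
    SE-transport (subst-pair (nat σ δ wk) p) generator-image
      (se-gen (fun σ δ) (subst (ty T) (nat σ δ wk) p))
    where
    generator-image :
      _≡_ {A = ∫ _}
        (res Γ (fun σ δ) wk , subst (ty T) (wk-z0 Γ (fun σ δ)) (tres T (subst (ty T) (nat σ δ wk) p) z0))
        (fun σ (res Δ δ wk) , subst (ty (T [ σ ])) (wk-z0 Δ δ) (tres (T [ σ ]) p z0))
    generator-image = begin
      _                                                         ≡⟨ generator-end (fun σ δ) _ ⟩
      (res Γ (fun σ δ) wk , subst (ty T) (nat σ δ wk) p) · z0   ≡⟨ cong (_· z0) (subst-pair (nat σ δ wk) p) ⟩
      (fun σ (res Δ δ wk) , p) · z0                             ≡⟨ sym (generator-end-σ δ p) ⟩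
      _                                                         ∎
  SE[σ]⊆SE se-refl          = se-refl
  SE[σ]⊆SE (se-sym h)       = se-sym (SE[σ]⊆SE h)
  SE[σ]⊆SE (se-trans h k)   = se-trans (SE[σ]⊆SE h) (SE[σ]⊆SE k)
  SE[σ]⊆SE (se-res {γ = δ} φ h) =
    SE-transport (sym (res-σ δ _ φ)) (sym (res-σ δ _ φ)) (se-res φ (SE[σ]⊆SE h))

  generator⊆SE[σ] : ∀ {W V} (γ : ob Γ W) (p : ty T (res Γ γ wk))
                    (ψ : Hom V W) (a : PVal (nb V) (np V))
                    (δ : ob Δ V) (x' y' : ty T (fun σ δ)) →
                    (fun σ δ , x') ≡ (res Γ γ wk , p) · ext ψ a →
                    (fun σ δ , y') ≡ (res Γ γ wk , subst (ty T) (wk-z0 Γ γ) (tres T p z0)) · ext ψ a →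
                    SE (T [ σ ]) δ x' y'
  generator⊆SE[σ] γ p ψ a δ x' y' ex ey =
    SE[σ]-transport section-cancels restrict-p restrict-p0
      (se-res (section a) (se-gen δ q))
    where
    u : ∫ _
    u = res Γ γ wk , p

    lifted-base : res Γ (res Γ γ wk) (lift ψ) ≡ fun σ (res Δ δ wk)
    lifted-base = begin
      res Γ (res Γ γ wk) (lift ψ)                  ≡⟨ res-∘ Γ γ wk (lift ψ) ⟩
      res Γ γ (wk ⊙ lift ψ)                         ≡⟨ cong (res Γ γ) (wk-lift ψ a) ⟩
      res Γ γ ((wk ⊙ ext ψ a) ⊙ wk)                 ≡⟨ sym (res-∘ Γ γ (wk ⊙ ext ψ a) wk) ⟩
      res Γ (res Γ γ (wk ⊙ ext ψ a)) wk             ≡⟨ cong (λ g → res Γ g wk) (sym (res-∘ Γ γ wk (ext ψ a))) ⟩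
      res Γ (res Γ (res Γ γ wk) (ext ψ a)) wk       ≡⟨ cong (λ g → res Γ g wk) (sym (cong proj₁ ex)) ⟩
      res Γ (fun σ δ) wk                            ≡⟨ sym (nat σ δ wk) ⟩
      fun σ (res Δ δ wk)                            ∎

    q : ty T (fun σ (res Δ δ wk))
    q = subst (ty T) lifted-base (tres T p (lift ψ))

    q-is-lift : (fun σ (res Δ δ wk) , q) ≡ u · lift ψ
    q-is-lift = subst-pair lifted-base (tres T p (lift ψ))

    section-cancels : res Δ (res Δ δ wk) (section a) ≡ δ
    section-cancels = begin
      res Δ (res Δ δ wk) (section a)   ≡⟨ res-∘ Δ δ wk (section a) ⟩
      res Δ δ (wk ⊙ section a)         ≡⟨ cong (res Δ δ) (wk-ext idH a) ⟩
      res Δ δ idH                      ≡⟨ res-id Δ δ ⟩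
      δ                                ∎

    q₀ : ty T (fun σ (res Δ δ wk))
    q₀ = subst (ty (T [ σ ])) (wk-z0 Δ δ) (tres (T [ σ ]) q z0)

    restrict-p : (fun σ (res Δ (res Δ δ wk) (section a)) , tres (T [ σ ]) q (section a))
                 ≡ (fun σ δ , x')
    restrict-p = begin
      _                                        ≡⟨ res-σ (res Δ δ wk) q (section a) ⟩
      (fun σ (res Δ δ wk) , q) · section a     ≡⟨ cong (_· section a) q-is-lift ⟩
      (u · lift ψ) · section a                 ≡⟨ ·-∘ u (lift ψ) (section a) ⟩
      u · (lift ψ ⊙ section a)                 ≡⟨ cong (u ·_) (lift-section ψ a) ⟩
      u · ext ψ a                              ≡⟨ sym ex ⟩
      (fun σ δ , x')                           ∎

    restrict-p0 : (fun σ (res Δ (res Δ δ wk) (section a)) , tres (T [ σ ]) q₀ (section a))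
                  ≡ (fun σ δ , y')
    restrict-p0 = begin
      _                                        ≡⟨ res-σ (res Δ δ wk) q₀ (section a) ⟩
      (fun σ (res Δ δ wk) , q₀) · section a    ≡⟨ cong (_· section a) (generator-end-σ δ q) ⟩
      ((fun σ (res Δ δ wk) , q) · z0) · section a
                                               ≡⟨ cong (λ v → (v · z0) · section a) q-is-lift ⟩
      ((u · lift ψ) · z0) · section a          ≡⟨ cong (_· section a) (·-∘ u (lift ψ) z0) ⟩
      (u · (lift ψ ⊙ z0)) · section a          ≡⟨ ·-∘ u (lift ψ ⊙ z0) (section a) ⟩
      u · ((lift ψ ⊙ z0) ⊙ section a)          ≡⟨ cong (u ·_) (lift-z0 ψ a) ⟩
      u · (z0 ⊙ ext ψ a)                       ≡⟨ sym (·-∘ u z0 (ext ψ a)) ⟩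
      (u · z0) · ext ψ a                       ≡⟨ cong (_· ext ψ a) (sym (generator-end γ p)) ⟩
      _                                        ≡⟨ sym ey ⟩
      (fun σ δ , y')                           ∎

  SE⊆SE[σ] : ∀ {W} {γ : ob Γ W} {x y : ty T γ} → SE T γ x y →
             ∀ {V} (φ : Hom V W) (δ : ob Δ V) (x' y' : ty T (fun σ δ)) →
             (fun σ δ , x') ≡ (γ , x) · φ → (fun σ δ , y') ≡ (γ , y) · φ →
             SE (T [ σ ]) δ x' y'
  SE⊆SE[σ] (se-gen γ p) (hom B (a ∷ R)) δ x' y' ex ey =
    generator⊆SE[σ] γ p (hom B R) a δ x' y' ex ey
  SE⊆SE[σ] se-refl φ δ x' y' ex ey =
    SE[σ]-transport refl refl (trans ex (sym ey)) se-refl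
  SE⊆SE[σ] (se-sym h) φ δ x' y' ex ey = se-sym (SE⊆SE[σ] h φ δ y' x' ey ex)
  SE⊆SE[σ] {γ = γ} (se-trans {y = z} h k) φ δ x' y' ex ey =
    se-trans (SE⊆SE[σ] h φ δ x' z' ex z'-is-z) (SE⊆SE[σ] k φ δ z' y' z'-is-z ey)
    where
    z' : ty T (fun σ δ)
    z' = subst (ty T) (sym (cong proj₁ ex)) (tres T z φ)

    z'-is-z : (fun σ δ , z') ≡ (γ , z) · φ
    z'-is-z = subst-pair (sym (cong proj₁ ex)) (tres T z φ)
  SE⊆SE[σ] (se-res {γ = γ} {x = x} {y = y} ψ h) φ δ x' y' ex ey =
    SE⊆SE[σ] h (ψ ⊙ φ) δ x' y' (trans ex (·-∘ (γ , x) ψ φ)) (trans ey (·-∘ (γ , y) ψ φ))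

lemma4p33 : (Δ Γ : PSh) (σ : PShHom Δ Γ) (T : Ty Γ) →
    ∀ {W} (δ : ob Δ W) (x y : ty T (fun σ δ)) →
    SE T (fun σ δ) x y ⇔ SE (T [ σ ]) δ x y
lemma4p33 Δ Γ σ T δ x y = mk⇔
  (λ h → SE⊆SE[σ] σ T h idH δ x y (·-id (fun σ δ , x)) (·-id (fun σ δ , y)))
  (SE[σ]⊆SE σ T)
  where open Total T
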